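{- Let $G=(V,E)$ be a graph, let $(A,B,D,M)$ be a nice decomposition of $G$, and let $H=H(G,A,B,D,M)$. Let $X\subseteq V$ and $X_{\mathrm{op}}=X_{\mathrm{op}}(A_1,A_3,M,X)$. Suppose there is a nonempty set $Z\subseteq A\setminus X$ such that (1) $X\cup Z$ is a vertex cover of $G$, (2) $M(z)\in X$ for all $z\in Z$, and (3) no vertex of $Z$ is reachable from $A_3$ in $H-X_{\mathrm{op}}$. Then there exists a vertex cover $\overline{X}$ of $G$ with $|\overline{X}|\le|X|$ and $Z\subseteq\overline{X}$. Moreover, $\overline{X}\cap D\subsetneq X\cap D$ and $\overline{X}\cap A\supsetneq X\cap A$.
   Context: Graphs are finite and simple; $N(D)$ is the set of vertices outside $D$ with a neighbor in $D$; for a matching $M$ and covered vertex $v$, $M(v)$ is the vertex matched to $v$. A graph is factor-critical if deleting any single vertex leaves a graph with a perfect matching. A relaxed Gallai-Edmonds decomposition of $G=(V,E)$ is a tuple $(A,B,D,M)$ with $V=A\,\dot\cup\, B\,\dot\cup\, D$ and $M$ a maximum matching of $G$ such that: (1) $A=N(D)$; (2) each component of $G[D]$ is factor-critical; (3) $M$ restricted to $B$ is a perfect matching of $G[B]$; (4) $M$ restricted to any component $C$ of $G[D]$ is a near-perfect matching of $G[C]$; (5) each vertex of $A$ is matched by $M$ to a vertex of $D$. A component of $G[D]$ is matched if some $M$-edge joins it to $A$, unmatched otherwise; the decomposition is nice if there is no unmatched single-vertex component. $A_1$, $A_3$: vertices of $A$ matched by $M$ to single-vertex resp. multi-vertex components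 of $G[D]$. For $X\subseteq V$, $X_{\mathrm{op}}(A_1,A_3,M,X)$ is the set of $v\in A$ with either $v\in A_1$ and $v,M(v)\in X$, or $v\in A_3$ and $v\in X$. $H(G,A,B,D,M)$ is the directed graph on vertex set $A$ with an arc $(u,v)$ whenever there is $w\in D$ with $\{u,w\}\in E\setminus M$ and $\{w,v\}\in M$. Reachability allows paths of length zero. -}

module Defs where

open import Data.Nat using (ℕ; zero; suc; _+_; _≤_)
open import Data.Fin using (Fin; zero; suc)
open import Data.Bool using (Bool; true; false; T; if_then_else_)
open import Data.Fin.Subset using (Subset; _∈_; _∉_; _⊆_; _⊂_; _∩_; _∪_; ∣_∣; Nonempty)
open import Data.Product using (Σ; ∃; ∃-syntax; _×_; _,_)
open import Data.Sum using (_⊎_)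
open import Relation.Nullary using (¬_)
open import Relation.Binary.PropositionalEquality using (_≡_; _≢_)

record Graph (n : ℕ) : Set where
  field
    adj    : Fin n → Fin n → Bool
    sym    : ∀ u v → adj u v ≡ adj v u
    irrefl : ∀ v → adj v v ≡ false
open Graph public

Edge : ∀ {n} → Graph n → Fin n → Fin n → Set
Edge G u v = T (adj G u v)

-- Boolean edge sets (used for matchings): M u v = true iff {u,v} ∈ M.
BRel : ℕ → Set
BRel n = Fin n → Fin n → Bool

InM : ∀ {n} → BRel n → Fin n → Fin n → Set
InM M u v = T (M u v)

IsMatching : ∀ {n} → Graph n → BRel n → Set
IsMatching G M =
  (∀ u v → M u v ≡ M v u) ×
  (∀ u v → InM M u v → Edge G u v) ×
  (∀ u v w → InM M u v → InM M u w → v ≡ w)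

sumFin : ∀ n → (Fin n → ℕ) → ℕ
sumFin zero    f = 0
sumFin (suc n) f = f zero + sumFin n (λ i → f (suc i))

-- number of ordered pairs (u,v) with {u,v} ∈ M, i.e. twice the number of edges
size2 : ∀ {n} → BRel n → ℕ
size2 {n} M = sumFin n (λ u → sumFin n (λ v → if M u v then 1 else 0))

IsMaximumMatching : ∀ {n} → Graph n → BRel n → Set
IsMaximumMatching G M =
  IsMatching G M × (∀ M' → IsMatching G M' → size2 M' ≤ size2 M)

VPred : ℕ → Set₁
VPred n = Fin n → Set

IsPerfectMatchingOf : ∀ {n} → Graph n → VPred n → BRel n → Set
IsPerfectMatchingOf G S M' =
  IsMatching G M' ×
  (∀ u v → InM M' u v → S u × S v) ×
  (∀ u → S u → ∃[ w ] InM M' u w)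

FactorCritical : ∀ {n} → Graph n → VPred n → Set
FactorCritical G S =
  ∀ u → S u → ∃[ M' ] IsPerfectMatchingOf G (λ x → S x × x ≢ u) M'

data ReachIn {n} (G : Graph n) (D : Subset n) (u : Fin n) : Fin n → Set where
  here : ReachIn G D u u
  step : ∀ {v w} → ReachIn G D u v → Edge G v w → w ∈ D → ReachIn G D u w

-- the component of G[D] containing v (meaningful for v ∈ D)
Comp : ∀ {n} → Graph n → Subset n → Fin n → VPred n
Comp G D v u = ReachIn G D v u

SingletonComp : ∀ {n} → Graph n → Subset n → Fin n → Set
SingletonComp G D v = ∀ u → Comp G D v u → u ≡ v

NearPerfectOn : ∀ {n} → BRel n → VPred n → Set
NearPerfectOn M S =
  ∃[ u ] (S u × ¬ (∃[ w ] (InM M u w × S w)) ×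
          (∀ x → S x → x ≢ u → ∃[ w ] (InM M x w × S w)))

record RelaxedGED {n} (G : Graph n) (A B D : Subset n) (M : BRel n) : Set where
  field
    partition   : ∀ v → v ∈ A ⊎ v ∈ B ⊎ v ∈ D
    disjAB      : ∀ v → v ∈ A → v ∉ B
    disjAD      : ∀ v → v ∈ A → v ∉ D
    disjBD      : ∀ v → v ∈ B → v ∉ D
    maximum     : IsMaximumMatching G M
    A⊆N         : ∀ v → v ∈ A → v ∉ D × ∃[ w ] (w ∈ D × Edge G v w)
    N⊆A         : ∀ v → v ∉ D → ∀ w → w ∈ D → Edge G v w → v ∈ A
    factorCrit  : ∀ v → v ∈ D → FactorCritical G (Comp G D v)
    perfectB    : ∀ b → b ∈ B → ∃[ w ] (InM M b w × w ∈ B)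
    nearPerfect : ∀ v → v ∈ D → NearPerfectOn M (Comp G D v)
    matchA      : ∀ a → a ∈ A → ∃[ w ] (InM M a w × w ∈ D)

Nice : ∀ {n} → Graph n → Subset n → Subset n → BRel n → Set
Nice G A D M =
  ∀ v → v ∈ D → SingletonComp G D v → ∃[ a ] (a ∈ A × InM M a v)

A₁ : ∀ {n} → Graph n → Subset n → Subset n → BRel n → VPred n
A₁ G A D M a = a ∈ A × ∃[ w ] (InM M a w × w ∈ D × SingletonComp G D w)

A₃ : ∀ {n} → Graph n → Subset n → Subset n → BRel n → VPred n
A₃ G A D M a = a ∈ A × ∃[ w ] (InM M a w × w ∈ D × ¬ SingletonComp G D w)

Xop : ∀ {n} → Graph n → Subset n → Subset n → BRel n → Subset n → VPred n
Xop G A D M X v =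
  (A₁ G A D M v × v ∈ X × ∃[ w ] (InM M v w × w ∈ X)) ⊎
  (A₃ G A D M v × v ∈ X)

HArc : ∀ {n} → Graph n → Subset n → Subset n → BRel n → Fin n → Fin n → Set
HArc G A D M u v =
  u ∈ A × v ∈ A ×
  ∃[ w ] (w ∈ D × Edge G u w × ¬ InM M u w × InM M w v)

data HReach {n} (G : Graph n) (A D : Subset n) (M : BRel n) (R : VPred n)
            (a : Fin n) : Fin n → Set where
  start : a ∈ A → ¬ R a → HReach G A D M R a a
  step  : ∀ {u v} → HReach G A D M R a u → HArc G A D M u v → ¬ R v →
          HReach G A D M R a v

IsVertexCover : ∀ {n} → Graph n → Subset n → Set
IsVertexCover G X = ∀ u v → Edge G u v → u ∈ X ⊎ v ∈ X

-- Starting from X, repeatedly swap a vertex v ∈ A ∖ X into the cover and its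
-- M-partner M(v) ∈ X ∩ D out of it, where v is either in Z or has an arc of H
-- into a vertex swapped in earlier. Every swapped-in vertex stays unreachable
-- from A₃ in H − X_op. Once no swap is possible the set is still a cover: an
-- edge {M(t), v} uncovered after t was swapped in would either make t's
-- component of G[D] non-trivial, so t ∈ A₃ reaches itself, or give an arc
-- v → t of H, so v could still be swapped in.
module Submission where

open import Defs hiding (sym)
open import Data.Nat using (suc; _+_; _≤_; z≤n; s≤s)
open import Data.Nat.Properties using (≤-trans; ≤-refl; ≤-reflexive; +-suc; +-comm; +-monoʳ-≤; n≤1+n; module ≤-Reasoning)
open import Data.Fin using (Fin; _≟_)
open import Data.Fin.Properties using (any?)
open import Data.Fin.Subset using (Subset; inside; outside; _∈_; _∉_; _⊆_; _⊂_; _⊃_; _∩_; _∪_; _─_; _-_; ⁅_⁆; ∣_∣; Nonempty)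
open import Data.Fin.Subset.Properties using (_∈?_; x∈p∩q⁺; x∈p∩q⁻; x∈p∪q⁺; x∈p∪q⁻; x∈⁅x⁆; x∈⁅y⁆⇒x≡y; x∉⁅y⁆⇒x≢y; ∣⁅x⁆∣≡1; p─q⊆p; x∈p∧x≢y⇒x∈p-y; x∈p⇒∣p-x∣<∣p∣)
open import Data.Fin.Subset.Induction using (Acc; acc; ⊃-wellFounded)
open import Data.Vec using ([]; _∷_; here; there)
open import Data.Bool using (T)
open import Data.Product using (∃-syntax; _×_; _,_; proj₁; proj₂)
open import Data.Sum using (_⊎_; inj₁; inj₂; [_,_]′)
open import Data.Empty using (⊥; ⊥-elim)
open import Function using (_∘_)
open import Relation.Nullary using (¬_; Dec; yes; no; contradiction)
open import Relation.Nullary.Decidable using (_×-dec_; _⊎-dec_; ¬?; T?)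
open import Relation.Binary.PropositionalEquality using (_≡_; _≢_; refl; sym; cong; subst)

∣p∪q∣≤∣p∣+∣q∣ : ∀ {n} (p q : Subset n) → ∣ p ∪ q ∣ ≤ ∣ p ∣ + ∣ q ∣
∣p∪q∣≤∣p∣+∣q∣ []            []            = z≤n
∣p∪q∣≤∣p∣+∣q∣ (outside ∷ p) (outside ∷ q) = ∣p∪q∣≤∣p∣+∣q∣ p q
∣p∪q∣≤∣p∣+∣q∣ (outside ∷ p) (inside  ∷ q) =
  ≤-trans (s≤s (∣p∪q∣≤∣p∣+∣q∣ p q)) (≤-reflexive (sym (+-suc ∣ p ∣ ∣ q ∣)))
∣p∪q∣≤∣p∣+∣q∣ (inside  ∷ p) (outside ∷ q) = s≤s (∣p∪q∣≤∣p∣+∣q∣ p q)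
∣p∪q∣≤∣p∣+∣q∣ (inside  ∷ p) (inside  ∷ q) =
  s≤s (≤-trans (∣p∪q∣≤∣p∣+∣q∣ p q) (+-monoʳ-≤ ∣ p ∣ (n≤1+n ∣ q ∣)))

x∈p─q⇒x∉q : ∀ {n x} (p q : Subset n) → x ∈ p ─ q → x ∉ q
x∈p─q⇒x∉q (inside ∷ p) (outside ∷ q) here      ()
x∈p─q⇒x∉q (_      ∷ p) (_       ∷ q) (there h) (there h′) = x∈p─q⇒x∉q p q h h′

∣p-x∪⁅y⁆∣≤∣p∣ : ∀ {n x} {p : Subset n} y → x ∈ p → ∣ (p - x) ∪ ⁅ y ⁆ ∣ ≤ ∣ p ∣
∣p-x∪⁅y⁆∣≤∣p∣ {x = x} {p} y x∈p = begin
  ∣ (p - x) ∪ ⁅ y ⁆ ∣      ≤⟨ ∣p∪q∣≤∣p∣+∣q∣ (p - x) ⁅ y ⁆ ⟩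
  ∣ p - x ∣ + ∣ ⁅ y ⁆ ∣    ≡⟨ cong (∣ p - x ∣ +_) (∣⁅x⁆∣≡1 y) ⟩
  ∣ p - x ∣ + 1            ≡⟨ +-comm ∣ p - x ∣ 1 ⟩
  suc ∣ p - x ∣            ≤⟨ x∈p⇒∣p-x∣<∣p∣ x∈p ⟩
  ∣ p ∣                    ∎
  where open ≤-Reasoning

x∈p-y∪⁅z⁆⁻ : ∀ {n x y z} (p : Subset n) → x ∈ (p - y) ∪ ⁅ z ⁆ → x ≡ z ⊎ (x ≢ y × x ∈ p)
x∈p-y∪⁅z⁆⁻ {y = y} {z} p h with x∈p∪q⁻ (p - y) ⁅ z ⁆ h
... | inj₂ x∈⁅z⁆ = inj₁ (x∈⁅y⁆⇒x≡y z x∈⁅z⁆)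
... | inj₁ x∈p-y = inj₂ (x∉⁅y⁆⇒x≢y (x∈p─q⇒x∉q p ⁅ y ⁆ x∈p-y) , p─q⊆p p ⁅ y ⁆ x∈p-y)

x∈p-y∪⁅z⁆⁺ : ∀ {n x y z} {p : Subset n} → x ≡ z ⊎ (x ≢ y × x ∈ p) → x ∈ (p - y) ∪ ⁅ z ⁆
x∈p-y∪⁅z⁆⁺ {z = z} (inj₁ refl)         = x∈p∪q⁺ (inj₂ (x∈⁅x⁆ z))
x∈p-y∪⁅z⁆⁺         (inj₂ (x≢y , x∈p)) = x∈p∪q⁺ (inj₁ (x∈p∧x≢y⇒x∈p-y x∈p x≢y))

Xop⊆X : ∀ {n} {G : Graph n} {A D X : Subset n} (M : BRel n) {v} →
        Xop G A D M X v → v ∈ X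
Xop⊆X _ (inj₁ (_ , v∈X , _)) = v∈X
Xop⊆X _ (inj₂ (_ , v∈X))     = v∈X

HArc? : ∀ {n} (G : Graph n) (A D : Subset n) (M : BRel n) u v → Dec (HArc G A D M u v)
HArc? G A D M u v = (u ∈? A) ×-dec (v ∈? A) ×-dec
  any? (λ w → (w ∈? D) ×-dec T? (adj G u w) ×-dec ¬? (T? (M u w)) ×-dec T? (M w v))

module Decomposition {n} {G : Graph n} {A B D : Subset n} {M : BRel n}
                     (ged : RelaxedGED G A B D M) where
  open RelaxedGED ged

  Edge-sym : ∀ {u v} → Edge G u v → Edge G v u
  Edge-sym {u} {v} = subst T (Graph.sym G u v)

  Edge-irrefl : ∀ {u} → ¬ Edge G u u
  Edge-irrefl {u} = subst T (Graph.irrefl G u)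

  M-sym : ∀ {u v} → InM M u v → InM M v u
  M-sym {u} {v} = subst T (proj₁ (proj₁ maximum) u v)

  M⊆E : ∀ {u v} → InM M u v → Edge G u v
  M⊆E {u} {v} = proj₁ (proj₂ (proj₁ maximum)) u v

  M-functional : ∀ {u v w} → InM M u v → InM M u w → v ≡ w
  M-functional {u} {v} {w} = proj₂ (proj₂ (proj₁ maximum)) u v w

  M-injective : ∀ {u v w} → InM M u w → InM M v w → u ≡ v
  M-injective m m′ = M-functional (M-sym m) (M-sym m′)

  A-partner∈D : ∀ {a w} → a ∈ A → InM M a w → w ∈ D
  A-partner∈D a∈A m with matchA _ a∈A
  ... | w′ , m′ , w′∈D = subst (_∈ D) (M-functional m′ m) w′∈D

  A∩D-disjoint : ∀ {v} → v ∈ A → v ∈ D → ⊥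
  A∩D-disjoint v∈A = disjAD _ v∈A

  partner-of-A₃ : ∀ {t u v} → t ∈ A → InM M t u → Edge G u v → v ∈ D →
                  A₃ G A D M t
  partner-of-A₃ t∈A m e v∈D =
    t∈A , _ , m , A-partner∈D t∈A m ,
    λ single → Edge-irrefl (subst (Edge G _) (single _ (ReachIn.step ReachIn.here e v∈D)) e)

module Swapping {n} {G : Graph n} {A B D : Subset n} {M : BRel n}
                (ged : RelaxedGED G A B D M) (X Z : Subset n)
                (Z⊆A∖X : ∀ z → z ∈ Z → z ∈ A × z ∉ X)
                (X∪Z-cover : IsVertexCover G (X ∪ Z))
                (Z-partner∈X : ∀ z → z ∈ Z → ∃[ w ] (InM M z w × w ∈ X))
                (Z-unreachable : ∀ z → z ∈ Z → ¬ (∃[ a ] (A₃ G A D M a × HReach G A D M (Xop G A D M X) a z)))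
                where
  open RelaxedGED ged using (matchA; N⊆A)
  open Decomposition ged

  Unreachable : Fin n → Set
  Unreachable v = ¬ (∃[ a ] (A₃ G A D M a × HReach G A D M (Xop G A D M X) a v))

  record Invariant (Y : Subset n) : Set where
    field
      size≤             : ∣ Y ∣ ≤ ∣ X ∣
      added⊆A           : ∀ {v} → v ∈ Y → v ∉ X → v ∈ A
      added-unreachable : ∀ {v} → v ∈ Y → v ∉ X → Unreachable v
      added-partner∉    : ∀ {v w} → v ∈ Y → v ∉ X → InM M v w → w ∉ Y
      removed-partner   : ∀ {x} → x ∈ X → x ∉ Y → ∃[ t ] (t ∈ Y × t ∉ X × InM M t x)

  Invariant-X : Invariant X
  Invariant-X = record
    { size≤             = ≤-refl
    ; added⊆A           = λ v∈X v∉X → contradiction v∈X v∉X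
    ; added-unreachable = λ v∈X v∉X → contradiction v∈X v∉X
    ; added-partner∉    = λ v∈X v∉X → contradiction v∈X v∉X
    ; removed-partner   = λ x∈X x∉X → contradiction x∈X x∉X
    }

  Candidate : Subset n → Fin n → Set
  Candidate Y v = v ∈ A × v ∉ Y × v ∉ X ×
                  (v ∈ Z ⊎ ∃[ t ] (t ∈ Y × t ∉ X × HArc G A D M v t))

  Candidate? : ∀ Y v → Dec (Candidate Y v)
  Candidate? Y v = (v ∈? A) ×-dec ¬? (v ∈? Y) ×-dec ¬? (v ∈? X) ×-dec
    ((v ∈? Z) ⊎-dec any? (λ t → (t ∈? Y) ×-dec ¬? (t ∈? X) ×-dec HArc? G A D M v t))

  module Swap {Y : Subset n} (inv : Invariant Y) {v : Fin n} (cand : Candidate Y v) where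
    open Invariant inv

    v∈A : v ∈ A
    v∈A = proj₁ cand
    v∉Y : v ∉ Y
    v∉Y = proj₁ (proj₂ cand)
    v∉X : v ∉ X
    v∉X = proj₁ (proj₂ (proj₂ cand))

    w : Fin n
    w = proj₁ (matchA v v∈A)
    v-w : InM M v w
    v-w = proj₁ (proj₂ (matchA v v∈A))
    w∈D : w ∈ D
    w∈D = proj₂ (proj₂ (matchA v v∈A))

    partner-of-Z∈X : v ∈ Z → w ∈ X
    partner-of-Z∈X v∈Z with Z-partner∈X v v∈Z
    ... | w′ , v-w′ , w′∈X = subst (_∈ X) (M-functional v-w′ v-w) w′∈X

    w∈X : w ∈ X
    w∈X with X∪Z-cover v w (M⊆E v-w)
    ... | inj₁ v∈X∪Z = [ (λ v∈X → contradiction v∈X v∉X) , partner-of-Z∈X ]′ (x∈p∪q⁻ X Z v∈X∪Z)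
    ... | inj₂ w∈X∪Z = [ (λ w∈X → w∈X) , (λ w∈Z → ⊥-elim (A∩D-disjoint (proj₁ (Z⊆A∖X w w∈Z)) w∈D)) ]′
                           (x∈p∪q⁻ X Z w∈X∪Z)

    w∈Y : w ∈ Y
    w∈Y with w ∈? Y
    ... | yes w∈Y = w∈Y
    ... | no w∉Y with removed-partner w∈X w∉Y
    ... | t , t∈Y , _ , t-w = contradiction (subst (_∈ Y) (M-injective t-w v-w) t∈Y) v∉Y

    v-unreachable : Unreachable v
    v-unreachable with proj₂ (proj₂ (proj₂ cand))
    ... | inj₁ v∈Z = Z-unreachable v v∈Z
    ... | inj₂ (t , t∈Y , t∉X , v→t) = λ (a , a∈A₃ , a⇝v) →
      added-unreachable t∈Y t∉X (a , a∈A₃ , HReach.step a⇝v v→t (t∉X ∘ Xop⊆X M))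

    Y′ : Subset n
    Y′ = (Y - w) ∪ ⁅ v ⁆

    v∈Y′ : v ∈ Y′
    v∈Y′ = x∈p-y∪⁅z⁆⁺ (inj₁ refl)

    w∉Y′ : w ∉ Y′
    w∉Y′ h with x∈p-y∪⁅z⁆⁻ Y h
    ... | inj₁ w≡v        = A∩D-disjoint v∈A (subst (_∈ D) w≡v w∈D)
    ... | inj₂ (w≢w , _)  = w≢w refl

    ∈Y′⇒∈Y : ∀ {x} → x ∈ Y′ → x ≢ v → x ∈ Y
    ∈Y′⇒∈Y h x≢v with x∈p-y∪⁅z⁆⁻ Y h
    ... | inj₁ x≡v       = contradiction x≡v x≢v
    ... | inj₂ (_ , x∈Y) = x∈Y

    added-partner∉′ : ∀ {x u} → x ∈ Y′ → x ∉ X → InM M x u → u ∉ Y′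
    added-partner∉′ x∈Y′ x∉X x-u u∈Y′ with x∈p-y∪⁅z⁆⁻ Y x∈Y′ | x∈p-y∪⁅z⁆⁻ Y u∈Y′
    ... | inj₁ refl          | _                 = w∉Y′ (subst (_∈ Y′) (M-functional x-u v-w) u∈Y′)
    ... | inj₂ (x≢w , _)     | inj₁ refl         = x≢w (M-functional (M-sym x-u) v-w)
    ... | inj₂ (_ , x∈Y)     | inj₂ (_ , u∈Y)    = added-partner∉ x∈Y x∉X x-u u∈Y

    removed-partner′ : ∀ {x} → x ∈ X → x ∉ Y′ → ∃[ t ] (t ∈ Y′ × t ∉ X × InM M t x)
    removed-partner′ {x} x∈X x∉Y′ with x ≟ w | x ∈? Y
    ... | yes refl | _     = v , v∈Y′ , v∉X , v-w
    ... | no x≢w   | yes x∈Y = contradiction (x∈p-y∪⁅z⁆⁺ (inj₂ (x≢w , x∈Y))) x∉Y′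
    ... | no _     | no x∉Y with removed-partner x∈X x∉Y
    ... | t , t∈Y , t∉X , t-x =
      t , x∈p-y∪⁅z⁆⁺ (inj₂ ((λ t≡w → t∉X (subst (_∈ X) (sym t≡w) w∈X)) , t∈Y)) , t∉X , t-x

    invariant : Invariant Y′
    invariant = record
      { size≤             = ≤-trans (∣p-x∪⁅y⁆∣≤∣p∣ v w∈Y) size≤
      ; added⊆A           = λ x∈Y′ x∉X → case-v x∈Y′ v∈A (λ x∈Y → added⊆A x∈Y x∉X)
      ; added-unreachable = λ x∈Y′ x∉X →
                              case-v x∈Y′ v-unreachable (λ x∈Y → added-unreachable x∈Y x∉X)
      ; added-partner∉    = added-partner∉′
      ; removed-partner   = removed-partner′
      }
      where
      case-v : ∀ {x} {P : Fin n → Set} → x ∈ Y′ → P v → (x ∈ Y → P x) → P x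
      case-v {x} x∈Y′ Pv old with x ≟ v
      ... | yes refl = Pv
      ... | no x≢v   = old (∈Y′⇒∈Y x∈Y′ x≢v)

    grows : (Y ∩ A) ⊂ (Y′ ∩ A)
    grows = keep , v , x∈p∩q⁺ (v∈Y′ , v∈A) , v∉Y ∘ proj₁ ∘ x∈p∩q⁻ Y A
      where
      keep : (Y ∩ A) ⊆ (Y′ ∩ A)
      keep h with x∈p∩q⁻ Y A h
      ... | x∈Y , x∈A =
        x∈p∩q⁺ (x∈p-y∪⁅z⁆⁺ (inj₂ ((λ { refl → A∩D-disjoint x∈A w∈D }) , x∈Y)) , x∈A)

  Saturated : Subset n → Set
  Saturated Y = ∀ v → ¬ Candidate Y v

  saturate : ∀ {Y} → Invariant Y → Acc _⊃_ (Y ∩ A) → ∃[ Y′ ] (Invariant Y′ × Saturated Y′)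
  saturate {Y} inv (acc rs) with any? (Candidate? Y)
  ... | no none        = Y , inv , λ v c → none (v , c)
  ... | yes (v , cand) = saturate (Swap.invariant inv cand) (rs (Swap.grows inv cand))

  module Saturation {Y : Subset n} (inv : Invariant Y) (sat : Saturated Y) where
    open Invariant inv

    Z⊆Y : Z ⊆ Y
    Z⊆Y {z} z∈Z with z ∈? Y | Z⊆A∖X z z∈Z
    ... | yes z∈Y | _           = z∈Y
    ... | no z∉Y  | z∈A , z∉X   = ⊥-elim (sat z (z∈A , z∉Y , z∉X , inj₁ z∈Z))

    X∩A⊆Y : ∀ {x} → x ∈ X → x ∈ A → x ∈ Y
    X∩A⊆Y {x} x∈X x∈A with x ∈? Y
    ... | yes x∈Y = x∈Y
    ... | no x∉Y with removed-partner x∈X x∉Y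
    ... | t , t∈Y , t∉X , t-x = ⊥-elim (A∩D-disjoint x∈A (A-partner∈D (added⊆A t∈Y t∉X) t-x))

    -- t reaches itself by the empty path, so its partner has no neighbour in D.
    removed-neighbour∈A : ∀ {t u v} → t ∈ Y → t ∉ X → InM M t u → Edge G u v → v ∈ A
    removed-neighbour∈A {t} {u} {v} t∈Y t∉X t-u e with v ∈? D
    ... | yes v∈D = ⊥-elim (added-unreachable t∈Y t∉X
                      (t , partner-of-A₃ t∈A t-u e v∈D , HReach.start t∈A (t∉X ∘ Xop⊆X M)))
      where
      t∈A : t ∈ A
      t∈A = added⊆A t∈Y t∉X
    ... | no v∉D  = N⊆A v v∉D u (A-partner∈D (added⊆A t∈Y t∉X) t-u) (Edge-sym e)

    covers-edge-from-X∪Z : ∀ {u v} → Edge G u v → u ∈ X ∪ Z → u ∈ Y ⊎ v ∈ Y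
    covers-edge-from-X∪Z {u} {v} e u∈X∪Z with x∈p∪q⁻ X Z u∈X∪Z | u ∈? Y | v ∈? Y
    ... | inj₂ u∈Z | _       | _       = inj₁ (Z⊆Y u∈Z)
    ... | inj₁ _   | yes u∈Y | _       = inj₁ u∈Y
    ... | inj₁ _   | no _    | yes v∈Y = inj₂ v∈Y
    ... | inj₁ u∈X | no u∉Y  | no v∉Y with removed-partner u∈X u∉Y
    ... | t , t∈Y , t∉X , t-u =
      ⊥-elim (sat v (v∈A , v∉Y , v∉Y ∘ (λ v∈X → X∩A⊆Y v∈X v∈A) , inj₂ (t , t∈Y , t∉X , v→t)))
      where
      v∈A : v ∈ A
      v∈A = removed-neighbour∈A t∈Y t∉X t-u e
      t∈A : t ∈ A
      t∈A = added⊆A t∈Y t∉X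
      v→t : HArc G A D M v t
      v→t = v∈A , t∈A , u , A-partner∈D t∈A t-u , Edge-sym e ,
            (λ v-u → v∉Y (subst (_∈ Y) (M-injective t-u v-u) t∈Y)) , M-sym t-u

    covers : IsVertexCover G Y
    covers u v e with X∪Z-cover u v e
    ... | inj₁ u∈X∪Z = covers-edge-from-X∪Z e u∈X∪Z
    ... | inj₂ v∈X∪Z = [ inj₂ , inj₁ ]′ (covers-edge-from-X∪Z (Edge-sym e) v∈X∪Z)

    Y∩D⊆X∩D : (Y ∩ D) ⊆ (X ∩ D)
    Y∩D⊆X∩D {x} h with x∈p∩q⁻ Y D h | x ∈? X
    ... | _ , x∈D   | yes x∈X = x∈p∩q⁺ (x∈X , x∈D)
    ... | x∈Y , x∈D | no x∉X  = ⊥-elim (A∩D-disjoint (added⊆A x∈Y x∉X) x∈D)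

    X∩A⊆Y∩A : (X ∩ A) ⊆ (Y ∩ A)
    X∩A⊆Y∩A h with x∈p∩q⁻ X A h
    ... | x∈X , x∈A = x∈p∩q⁺ (X∩A⊆Y x∈X x∈A , x∈A)

    D-shrinks : Nonempty Z → (Y ∩ D) ⊂ (X ∩ D)
    D-shrinks (z , z∈Z) with Z⊆A∖X z z∈Z | Z-partner∈X z z∈Z
    ... | z∈A , z∉X | w , z-w , w∈X =
      Y∩D⊆X∩D , w , x∈p∩q⁺ (w∈X , A-partner∈D z∈A z-w) ,
      added-partner∉ (Z⊆Y z∈Z) z∉X z-w ∘ proj₁ ∘ x∈p∩q⁻ Y D

    A-grows : Nonempty Z → (X ∩ A) ⊂ (Y ∩ A)
    A-grows (z , z∈Z) with Z⊆A∖X z z∈Z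
    ... | z∈A , z∉X = X∩A⊆Y∩A , z , x∈p∩q⁺ (Z⊆Y z∈Z , z∈A) , z∉X ∘ proj₁ ∘ x∈p∩q⁻ X A

lemma20 : ∀ {n} (G : Graph n) (A B D : Subset n) (M : BRel n) →
    RelaxedGED G A B D M → Nice G A D M →
    (X Z : Subset n) →
    Nonempty Z →
    (∀ z → z ∈ Z → z ∈ A × z ∉ X) →
    IsVertexCover G (X ∪ Z) →
    (∀ z → z ∈ Z → ∃[ w ] (InM M z w × w ∈ X)) →
    (∀ z → z ∈ Z → ¬ (∃[ a ] (A₃ G A D M a × HReach G A D M (Xop G A D M X) a z))) →
    ∃[ X̄ ] (IsVertexCover G X̄ × ∣ X̄ ∣ ≤ ∣ X ∣ × Z ⊆ X̄ ×
            (X̄ ∩ D) ⊂ (X ∩ D) × (X ∩ A) ⊂ (X̄ ∩ A))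
lemma20 G A B D M ged _ X Z Z≠∅ Z⊆A∖X X∪Z-cover Z-partner∈X Z-unreachable =
  Y , covers , size≤ , Z⊆Y , D-shrinks Z≠∅ , A-grows Z≠∅
  where
  open Swapping ged X Z Z⊆A∖X X∪Z-cover Z-partner∈X Z-unreachable
  saturation : ∃[ Y ] (Invariant Y × Saturated Y)
  saturation = saturate Invariant-X (⊃-wellFounded (X ∩ A))
  Y : Subset _
  Y = proj₁ saturation
  open Invariant (proj₁ (proj₂ saturation)) using (size≤)
  open Saturation (proj₁ (proj₂ saturation)) (proj₂ (proj₂ saturation))
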